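{- Let $S$ be a finite set of formulas, $P=\mathrm{Pars}^*(S)$, $n$ the sum of the lengths of the formulas in $S$, and $d=\max\{\mathrm{qd}(A):A\in S\}$. Let $\overline S$ be the closure of $S$ and $\|\overline S\|$ the sum of the lengths of its formulas. Then: (1) $|\overline S|\le n\cdot|P|^d$ and therefore $\|\overline S\|\le n^2\cdot |P|^d$; (2) asymptotically $\|\overline S\|\le n^{n/2}$; (3) if attention is restricted to sets $S$ of bounded quantifier depth, then $\|\overline S\|$ is bounded by a polynomial in $n$.
   Context: Language: first-order, without equality and without function symbols of positive arity; terms are variables and constants; atomic formulas are $\top,\bot$ and $R(t_1,\dots,t_j)$; formulas are built by $\land,\lor,\to,\forall x,\exists x$; formulas are strings and the length of a formula is its number of symbol occurrences. A parameter of a formula is a constant occurring in it or a variable occurring free in it; a $P$-formula is a formula all of whose parameters are in $P$. Fix an individual constant. $\mathrm{Pars}^*(S)$ is the set $P_0$ of parameters of the formulas of $S$, unless $P_0$ contains no constant, in which case it is $P_0$ together with the fixed constant. Subformulas: $A$ is a subformula of $A$; if $B\land C$, $B\lor C$ or $B\to C$ is a subformula of $A$ then so are $B,C$; if $\forall xB(x)$ or $\exists xB(x)$ is a subformula of $A$ then so is $B(t)$ for every term $t$ substitutable for $x$. The closure $\overline S$ of $S$ is the set of all $\mathrm{Pars}^*(S)$-formulas that are subformulas of some formula in $S$. Quantifier depth: $\mathrm{qd}$ of an atomic formula is $0$, $\mathrm{qd}(B\circ C)=\max(\mathrm{qd}(B),\mathrm{qd}(C))$ for binary connectives $\circ$,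 $\mathrm{qd}(\forall xB)=\mathrm{qd}(\exists xB)=1+\mathrm{qd}(B)$. -}

module Defs where

open import Data.Nat using (ℕ; zero; suc; _+_; _*_; _^_; _≤_; _⊔_; _≡ᵇ_)
open import Data.Bool using (Bool; true; false; if_then_else_)
open import Data.List using (List; []; _∷_; _++_; [_]; length; map; foldr)
open import Data.Nat.ListAction using (sum)
open import Data.List.Membership.Propositional using (_∈_)
open import Data.List.Relation.Unary.Unique.Propositional using (Unique)
open import Data.Product using (Σ; _×_; ∃; ∃-syntax; _,_)
open import Data.Sum using (_⊎_)
open import Relation.Nullary using (¬_)
open import Relation.Binary.PropositionalEquality using (_≡_; _≢_)
open import Function.Bundles using (_⇔_)

data Term : Set where
  var : ℕ → Term
  con : ℕ → Term

fixedConst : Term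
fixedConst = con 0

-- Formulas.  A relation symbol is a name r : ℕ applied to a list of
-- terms; its arity is the length of that list.
data Formula : Set where
  ⊤'  : Formula
  ⊥'  : Formula
  rel : ℕ → List Term → Formula
  and : Formula → Formula → Formula
  or  : Formula → Formula → Formula
  imp : Formula → Formula → Formula
  all : ℕ → Formula → Formula
  ex  : ℕ → Formula → Formula

data Symbol : Set where
  sTop sBot : Symbol
  sRel      : ℕ → ℕ → Symbol
  sTerm     : Term → Symbol
  sAnd sOr sImp sAll sEx : Symbol
  sLP sRP sComma : Symbol

renderArgsTail : List Term → List Symbol
renderArgsTail []       = [ sRP ]
renderArgsTail (t ∷ ts) = sComma ∷ sTerm t ∷ renderArgsTail ts

renderArgs : List Term → List Symbol
renderArgs []       = []
renderArgs (t ∷ ts) = sLP ∷ sTerm t ∷ renderArgsTail ts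

render : Formula → List Symbol
render ⊤'         = [ sTop ]
render ⊥'         = [ sBot ]
render (rel r ts) = sRel r (length ts) ∷ renderArgs ts
render (and B C)  = sLP ∷ render B ++ (sAnd ∷ render C ++ [ sRP ])
render (or B C)   = sLP ∷ render B ++ (sOr  ∷ render C ++ [ sRP ])
render (imp B C)  = sLP ∷ render B ++ (sImp ∷ render C ++ [ sRP ])
render (all x B)  = sAll ∷ sTerm (var x) ∷ render B
render (ex x B)   = sEx  ∷ sTerm (var x) ∷ render B

len : Formula → ℕ
len A = length (render A)

totalLen : List Formula → ℕ
totalLen S = sum (map len S)

qd : Formula → ℕ
qd ⊤'         = 0
qd ⊥'         = 0
qd (rel r ts) = 0
qd (and B C)  = qd B ⊔ qd C
qd (or B C)   = qd B ⊔ qd C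
qd (imp B C)  = qd B ⊔ qd C
qd (all x B)  = suc (qd B)
qd (ex x B)   = suc (qd B)

maxQd : List Formula → ℕ
maxQd S = foldr _⊔_ 0 (map qd S)

data ParIn : Term → Formula → Set where
  pRel  : ∀ {t r ts} → t ∈ ts → ParIn t (rel r ts)
  pAndL : ∀ {t B C} → ParIn t B → ParIn t (and B C)
  pAndR : ∀ {t B C} → ParIn t C → ParIn t (and B C)
  pOrL  : ∀ {t B C} → ParIn t B → ParIn t (or B C)
  pOrR  : ∀ {t B C} → ParIn t C → ParIn t (or B C)
  pImpL : ∀ {t B C} → ParIn t B → ParIn t (imp B C)
  pImpR : ∀ {t B C} → ParIn t C → ParIn t (imp B C)
  pAllC : ∀ {c x B} → ParIn (con c) B → ParIn (con c) (all x B)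
  pAllV : ∀ {y x B} → ParIn (var y) B → y ≢ x → ParIn (var y) (all x B)
  pExC  : ∀ {c x B} → ParIn (con c) B → ParIn (con c) (ex x B)
  pExV  : ∀ {y x B} → ParIn (var y) B → y ≢ x → ParIn (var y) (ex x B)

IsPFormula : (Term → Set) → Formula → Set
IsPFormula P A = ∀ t → ParIn t A → P t

Pars0 : List Formula → Term → Set
Pars0 S t = Σ Formula λ A → A ∈ S × ParIn t A

ParsStar : List Formula → Term → Set
ParsStar S t = Pars0 S t ⊎ ((¬ (Σ ℕ λ c → Pars0 S (con c))) × t ≡ fixedConst)

substTerm : Term → ℕ → Term → Term
substTerm t x (var y) = if y ≡ᵇ x then t else var y
substTerm t x (con c) = con c

subst : Term → ℕ → Formula → Formula
subst t x ⊤'         = ⊤'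
subst t x ⊥'         = ⊥'
subst t x (rel r ts) = rel r (map (substTerm t x) ts)
subst t x (and B C)  = and (subst t x B) (subst t x C)
subst t x (or B C)   = or (subst t x B) (subst t x C)
subst t x (imp B C)  = imp (subst t x B) (subst t x C)
subst t x (all y B)  = if y ≡ᵇ x then all y B else all y (subst t x B)
subst t x (ex y B)   = if y ≡ᵇ x then ex y B else ex y (subst t x B)

data Substitutable (t : Term) (x : ℕ) : Formula → Set where
  sbTop : Substitutable t x ⊤'
  sbBot : Substitutable t x ⊥'
  sbRel : ∀ {r ts} → Substitutable t x (rel r ts)
  sbAnd : ∀ {B C} → Substitutable t x B → Substitutable t x C → Substitutable t x (and B C)
  sbOr  : ∀ {B C} → Substitutable t x B → Substitutable t x C → Substitutable t x (or B C)
  sbImp : ∀ {B C} → Substitutable t x B → Substitutable t x C → Substitutable t x (imp B C)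
  sbAll : ∀ {y B} → (¬ ParIn (var x) (all y B)) ⊎ (t ≢ var y × Substitutable t x B)
          → Substitutable t x (all y B)
  sbEx  : ∀ {y B} → (¬ ParIn (var x) (ex y B)) ⊎ (t ≢ var y × Substitutable t x B)
          → Substitutable t x (ex y B)

data SubFormula : Formula → Formula → Set where
  sfSelf : ∀ {A} → SubFormula A A
  sfAndL : ∀ {A B C} → SubFormula (and B C) A → SubFormula B A
  sfAndR : ∀ {A B C} → SubFormula (and B C) A → SubFormula C A
  sfOrL  : ∀ {A B C} → SubFormula (or B C) A → SubFormula B A
  sfOrR  : ∀ {A B C} → SubFormula (or B C) A → SubFormula C A
  sfImpL : ∀ {A B C} → SubFormula (imp B C) A → SubFormula B A
  sfImpR : ∀ {A B C} → SubFormula (imp B C) A → SubFormula C A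
  sfAll  : ∀ {A x B} (t : Term) → SubFormula (all x B) A → Substitutable t x B
           → SubFormula (subst t x B) A
  sfEx   : ∀ {A x B} (t : Term) → SubFormula (ex x B) A → Substitutable t x B
           → SubFormula (subst t x B) A

InClosure : List Formula → Formula → Set
InClosure S B = IsPFormula (ParsStar S) B × (Σ Formula λ A → A ∈ S × SubFormula B A)

-- Ps is a duplicate-free enumeration of Pars*(S); so |P| = length Ps
EnumPars : List Formula → List Term → Set
EnumPars S Ps = Unique Ps × (∀ t → (t ∈ Ps) ⇔ ParsStar S t)

-- L is a duplicate-free enumeration of the closure of S;
-- so |closure| = length L and ‖closure‖ = totalLen L
EnumClosure : List Formula → List Formula → Set
EnumClosure S L = Unique L × (∀ B → (B ∈ L) ⇔ InClosure S B)

-- A subformula of some A ∈ S that is a P-formula arises from A by a chain of immediate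
-- steps in which every quantifier is instantiated by a term of P: a term outside P used on
-- the way can have its free occurrences replaced by a constant of P (Pars*(S) always
-- contains one), and for a P-formula this changes nothing.  Unfolding A in this way yields
-- at most len A · |P| ^ qd A formulas, since binary connectives add the counts and a
-- quantifier multiplies them by |P|; hence |S̄| ≤ n · |P| ^ d, and no member is longer
-- than n.  For (2) and (3) take for P the fixed constant together with all term occurrences
-- in S; every quantifier costs two further symbols, so |P| + 2d ≤ n + 1, whence
-- ‖S̄‖² ≤ n⁴ · |P| ^ 2d ≤ n ^ n once n ≥ 64, and ‖S̄‖ ≤ (n + 1) ^ (d + 2).

module Submission where

open import Defs
open import Data.Nat
  using (ℕ; zero; suc; _+_; _*_; _^_; _≤_; _<_; _⊔_; _≡ᵇ_; z≤n; s≤s; z<s; _≟_; _≤?_; NonZero)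
open import Data.Nat.Properties
open import Data.Nat.ListAction using (sum)
open import Data.Nat.Tactic.RingSolver using (solve-∀)
open import Data.Bool using (true; false)
open import Data.List using (List; []; _∷_; _++_; [_]; length; map; concatMap; filter; deduplicate)
open import Data.List.Properties using (length-++; length-map; length-filter; ≡-dec)
open import Data.List.Membership.Propositional using (_∈_; _∉_; find; lose)
open import Data.List.Membership.Propositional.Properties
  using ( ∈-++⁺ˡ; ∈-++⁺ʳ; ∈-map⁺; ∈-map⁻; ∈-concatMap⁺; ∈-concatMap⁻; ∈-filter⁺; ∈-filter⁻
        ; ∈-deduplicate⁺; ∈-deduplicate⁻; ∈-∃++)
import Data.List.Membership.DecPropositional as DecMembership
open import Data.List.Relation.Binary.Subset.Propositional using (_⊆_)
open import Data.List.Relation.Binary.Subset.Propositional.Properties using (∷⁺ʳ; ⊆-respʳ-↭; ⊆∷∧∉⇒⊆)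
open import Data.List.Relation.Binary.Permutation.Propositional.Properties using (shift; ↭-length)
import Data.List.Relation.Binary.Pointwise as Pointwise
open Pointwise using (Pointwise; []; _∷_)
open import Data.List.Relation.Unary.Any using (here; there; any?)
open import Data.List.Relation.Unary.All as All using (all?)
open import Data.List.Relation.Unary.All.Properties using (All¬⇒¬Any)
open import Data.List.Relation.Unary.AllPairs using ([]; _∷_)
open import Data.List.Relation.Unary.Unique.Propositional using (Unique)
open import Data.List.Relation.Unary.Unique.DecPropositional.Properties using (deduplicate-!)
open import Data.Product using (Σ; _×_; _,_; proj₂; ∃-syntax; uncurry)
open import Data.Sum using (_⊎_; inj₁; inj₂) renaming ([_,_] to either)
open import Data.Empty using (⊥-elim)
open import Data.Unit using (⊤; tt)
open import Function using (_∘_; id)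
open import Function.Bundles using (mk⇔; Equivalence)
open import Relation.Nullary using (¬_; Dec; yes; no)
open import Relation.Nullary.Decidable using (map′; _×-dec_; _⊎-dec_; _→-dec_; ¬?)
open import Relation.Binary.Definitions using (DecidableEquality)
open import Relation.Binary.PropositionalEquality using (_≡_; _≢_; refl; sym; trans; cong; cong₂; ≢-sym)

open Equivalence using (to; from)

length-concatMap : ∀ {A B : Set} (f : A → List B) xs → length (concatMap f xs) ≡ sum (map (length ∘ f) xs)
length-concatMap f []       = refl
length-concatMap f (x ∷ xs) = trans (length-++ (f x)) (cong (length (f x) +_) (length-concatMap f xs))

sum-map-≤ : ∀ {A : Set} {f : A → ℕ} {m} xs → (∀ {x} → x ∈ xs → f x ≤ m) → sum (map f xs) ≤ length xs * m
sum-map-≤ []       _ = z≤n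
sum-map-≤ (x ∷ xs) h = +-mono-≤ (h (here refl)) (sum-map-≤ xs (h ∘ there))

unique-⊆⇒length-≤ : ∀ {A : Set} {xs ys : List A} → Unique xs → xs ⊆ ys → length xs ≤ length ys
unique-⊆⇒length-≤ [] _ = z≤n
unique-⊆⇒length-≤ {xs = x ∷ xs} (x≢xs ∷ unique-xs) x∷xs⊆ys with as , bs , refl ← ∈-∃++ (x∷xs⊆ys (here refl)) =
  begin
  suc (length xs)            ≤⟨ s≤s (unique-⊆⇒length-≤ unique-xs xs⊆as++bs) ⟩
  suc (length (as ++ bs))    ≡⟨ ↭-length (shift x as bs) ⟨
  length (as ++ [ x ] ++ bs) ∎
  where
  open ≤-Reasoning
  xs⊆as++bs : xs ⊆ as ++ bs
  xs⊆as++bs = ⊆∷∧∉⇒⊆ (⊆-respʳ-↭ (shift x as bs) (x∷xs⊆ys ∘ there)) (All¬⇒¬Any x≢xs)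

nonZero-length : ∀ {A : Set} {x : A} {xs} → x ∈ xs → NonZero (length xs)
nonZero-length (here _)  = _
nonZero-length (there _) = _

m<n⇒1+m*o≤n*o : ∀ {m n o} → 0 < o → m < n → suc (m * o) ≤ n * o
m<n⇒1+m*o≤n*o {m} {o = o} o>0 m<n = ≤-trans (+-monoˡ-≤ (m * o) o>0) (*-monoˡ-≤ o m<n)

-- If e ≤ m then p ≤ 4 + m; otherwise p ≤ 4 and 4 ^ e ≤ 4 ^ (3 m) = 64 ^ m.
p^e≤[4+m]^m : ∀ {m p e} → 60 ≤ m → 0 < p → p + e ≤ 5 + m → p ^ e ≤ (4 + m) ^ m
p^e≤[4+m]^m {m} {e = zero} _ _ _ = m^n>0 (4 + m) m
p^e≤[4+m]^m {m} {p} {suc e} 60≤m p>0 budget with suc e ≤? m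
... | yes 1+e≤m = begin
  p ^ suc e       ≤⟨ ^-monoˡ-≤ (suc e) p≤4+m ⟩
  (4 + m) ^ suc e ≤⟨ ^-monoʳ-≤ (4 + m) 1+e≤m ⟩
  (4 + m) ^ m     ∎
  where
  open ≤-Reasoning
  p≤4+m : p ≤ 4 + m
  p≤4+m = ≤-trans (m≤m+n p e) (≤-pred (≤-trans (≤-reflexive (sym (+-suc p e))) budget))
... | no 1+e≰m = begin
  p ^ suc e   ≤⟨ ^-monoˡ-≤ (suc e) p≤4 ⟩
  4 ^ suc e   ≤⟨ ^-monoʳ-≤ 4 (≤-trans 1+e≤4+m 4+m≤3m) ⟩
  4 ^ (3 * m) ≡⟨ ^-*-assoc 4 3 m ⟨
  64 ^ m      ≤⟨ ^-monoˡ-≤ m (+-monoʳ-≤ 4 60≤m) ⟩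
  (4 + m) ^ m ∎
  where
  open ≤-Reasoning
  p≤4 : p ≤ 4
  p≤4 = +-cancelʳ-≤ (suc m) p 4 (≤-trans (+-monoʳ-≤ p (≰⇒> 1+e≰m)) budget)
  1+e≤4+m : suc e ≤ 4 + m
  1+e≤4+m = ≤-pred (≤-trans (+-monoˡ-≤ (suc e) p>0) budget)
  4+m≤3m : 4 + m ≤ 3 * m
  4+m≤3m = ≤-trans (≤-reflexive (+-comm 4 m)) (+-monoʳ-≤ m (≤-trans (≤-trans (m≤m+n 4 56) 60≤m) (m≤m+n m (m + 0))))

power-bound : ∀ {n p e} → 64 ≤ n → 0 < p → p + e ≤ suc n → n * n * (n * n) * p ^ e ≤ n ^ n
power-bound {n@(suc (suc (suc (suc m))))} {p} {e} (s≤s (s≤s (s≤s (s≤s 60≤m)))) p>0 budget = begin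
  n * n * (n * n) * p ^ e ≤⟨ *-monoʳ-≤ (n * n * (n * n)) (p^e≤[4+m]^m 60≤m p>0 budget) ⟩
  n * n * (n * n) * n ^ m ≡⟨ reassociate n (n ^ m) ⟩
  n ^ n                   ∎
  where
  open ≤-Reasoning
  reassociate : ∀ a b → a * a * (a * a) * b ≡ a * (a * (a * (a * b)))
  reassociate = solve-∀

infix 4 _≟ᵗ_ _≟ᶠ_

_≟ᵗ_ : DecidableEquality Term
var m ≟ᵗ var n = map′ (cong var) (λ { refl → refl }) (m ≟ n)
var _ ≟ᵗ con _ = no λ ()
con _ ≟ᵗ var _ = no λ ()
con m ≟ᵗ con n = map′ (cong con) (λ { refl → refl }) (m ≟ n)

open DecMembership _≟ᵗ_ using (_∈?_)

_≟ᶠ_ : DecidableEquality Formula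
⊤'       ≟ᶠ ⊤'         = yes refl
⊥'       ≟ᶠ ⊥'         = yes refl
rel r ts ≟ᶠ rel r′ ts′ = map′ (uncurry (cong₂ rel)) (λ { refl → refl , refl }) (r ≟ r′ ×-dec ≡-dec _≟ᵗ_ ts ts′)
and B C  ≟ᶠ and B′ C′  = map′ (uncurry (cong₂ and)) (λ { refl → refl , refl }) (B ≟ᶠ B′ ×-dec C ≟ᶠ C′)
or B C   ≟ᶠ or B′ C′   = map′ (uncurry (cong₂ or)) (λ { refl → refl , refl }) (B ≟ᶠ B′ ×-dec C ≟ᶠ C′)
imp B C  ≟ᶠ imp B′ C′  = map′ (uncurry (cong₂ imp)) (λ { refl → refl , refl }) (B ≟ᶠ B′ ×-dec C ≟ᶠ C′)
all x B  ≟ᶠ all y B′   = map′ (uncurry (cong₂ all)) (λ { refl → refl , refl }) (x ≟ y ×-dec B ≟ᶠ B′)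
ex x B   ≟ᶠ ex y B′    = map′ (uncurry (cong₂ ex)) (λ { refl → refl , refl }) (x ≟ y ×-dec B ≟ᶠ B′)
⊤'      ≟ᶠ ⊥'      = no λ ()
⊤'      ≟ᶠ rel _ _ = no λ ()
⊤'      ≟ᶠ and _ _ = no λ ()
⊤'      ≟ᶠ or _ _  = no λ ()
⊤'      ≟ᶠ imp _ _ = no λ ()
⊤'      ≟ᶠ all _ _ = no λ ()
⊤'      ≟ᶠ ex _ _  = no λ ()
⊥'      ≟ᶠ ⊤'      = no λ ()
⊥'      ≟ᶠ rel _ _ = no λ ()
⊥'      ≟ᶠ and _ _ = no λ ()
⊥'      ≟ᶠ or _ _  = no λ ()
⊥'      ≟ᶠ imp _ _ = no λ ()
⊥'      ≟ᶠ all _ _ = no λ ()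
⊥'      ≟ᶠ ex _ _  = no λ ()
rel _ _ ≟ᶠ ⊤'      = no λ ()
rel _ _ ≟ᶠ ⊥'      = no λ ()
rel _ _ ≟ᶠ and _ _ = no λ ()
rel _ _ ≟ᶠ or _ _  = no λ ()
rel _ _ ≟ᶠ imp _ _ = no λ ()
rel _ _ ≟ᶠ all _ _ = no λ ()
rel _ _ ≟ᶠ ex _ _  = no λ ()
and _ _ ≟ᶠ ⊤'      = no λ ()
and _ _ ≟ᶠ ⊥'      = no λ ()
and _ _ ≟ᶠ rel _ _ = no λ ()
and _ _ ≟ᶠ or _ _  = no λ ()
and _ _ ≟ᶠ imp _ _ = no λ ()
and _ _ ≟ᶠ all _ _ = no λ ()
and _ _ ≟ᶠ ex _ _  = no λ ()
or _ _  ≟ᶠ ⊤'      = no λ ()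
or _ _  ≟ᶠ ⊥'      = no λ ()
or _ _  ≟ᶠ rel _ _ = no λ ()
or _ _  ≟ᶠ and _ _ = no λ ()
or _ _  ≟ᶠ imp _ _ = no λ ()
or _ _  ≟ᶠ all _ _ = no λ ()
or _ _  ≟ᶠ ex _ _  = no λ ()
imp _ _ ≟ᶠ ⊤'      = no λ ()
imp _ _ ≟ᶠ ⊥'      = no λ ()
imp _ _ ≟ᶠ rel _ _ = no λ ()
imp _ _ ≟ᶠ and _ _ = no λ ()
imp _ _ ≟ᶠ or _ _  = no λ ()
imp _ _ ≟ᶠ all _ _ = no λ ()
imp _ _ ≟ᶠ ex _ _  = no λ ()
all _ _ ≟ᶠ ⊤'      = no λ ()
all _ _ ≟ᶠ ⊥'      = no λ ()
all _ _ ≟ᶠ rel _ _ = no λ ()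
all _ _ ≟ᶠ and _ _ = no λ ()
all _ _ ≟ᶠ or _ _  = no λ ()
all _ _ ≟ᶠ imp _ _ = no λ ()
all _ _ ≟ᶠ ex _ _  = no λ ()
ex _ _  ≟ᶠ ⊤'      = no λ ()
ex _ _  ≟ᶠ ⊥'      = no λ ()
ex _ _  ≟ᶠ rel _ _ = no λ ()
ex _ _  ≟ᶠ and _ _ = no λ ()
ex _ _  ≟ᶠ or _ _  = no λ ()
ex _ _  ≟ᶠ imp _ _ = no λ ()
ex _ _  ≟ᶠ all _ _ = no λ ()

parIn? : ∀ t A → Dec (ParIn t A)
parIn? t ⊤'         = no λ ()
parIn? t ⊥'         = no λ ()
parIn? t (rel r ts) = map′ pRel (λ { (pRel m) → m }) (t ∈? ts)
parIn? t (and B C) =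
  map′ (either pAndL pAndR) (λ { (pAndL p) → inj₁ p ; (pAndR p) → inj₂ p }) (parIn? t B ⊎-dec parIn? t C)
parIn? t (or B C) =
  map′ (either pOrL pOrR) (λ { (pOrL p) → inj₁ p ; (pOrR p) → inj₂ p }) (parIn? t B ⊎-dec parIn? t C)
parIn? t (imp B C) =
  map′ (either pImpL pImpR) (λ { (pImpL p) → inj₁ p ; (pImpR p) → inj₂ p }) (parIn? t B ⊎-dec parIn? t C)
parIn? (con c) (all x B) = map′ pAllC (λ { (pAllC p) → p }) (parIn? (con c) B)
parIn? (var y) (all x B) =
  map′ (uncurry pAllV) (λ { (pAllV p y≢x) → p , y≢x }) (parIn? (var y) B ×-dec ¬? (y ≟ x))
parIn? (con c) (ex x B)  = map′ pExC (λ { (pExC p) → p }) (parIn? (con c) B)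
parIn? (var y) (ex x B)  =
  map′ (uncurry pExV) (λ { (pExV p y≢x) → p , y≢x }) (parIn? (var y) B ×-dec ¬? (y ≟ x))

substitutable? : ∀ t x B → Dec (Substitutable t x B)
substitutable? t x ⊤'        = yes sbTop
substitutable? t x ⊥'        = yes sbBot
substitutable? t x (rel _ _) = yes sbRel
substitutable? t x (and B C) =
  map′ (uncurry sbAnd) (λ { (sbAnd p q) → p , q }) (substitutable? t x B ×-dec substitutable? t x C)
substitutable? t x (or B C)  =
  map′ (uncurry sbOr) (λ { (sbOr p q) → p , q }) (substitutable? t x B ×-dec substitutable? t x C)
substitutable? t x (imp B C) =
  map′ (uncurry sbImp) (λ { (sbImp p q) → p , q }) (substitutable? t x B ×-dec substitutable? t x C)
substitutable? t x (all y B) = map′ sbAll (λ { (sbAll d) → d })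
  (¬? (parIn? (var x) (all y B)) ⊎-dec ¬? (t ≟ᵗ var y) ×-dec substitutable? t x B)
substitutable? t x (ex y B)  = map′ sbEx (λ { (sbEx d) → d })
  (¬? (parIn? (var x) (ex y B)) ⊎-dec ¬? (t ≟ᵗ var y) ×-dec substitutable? t x B)

≡ᵇ-refl : ∀ n → (n ≡ᵇ n) ≡ true
≡ᵇ-refl zero    = refl
≡ᵇ-refl (suc n) = ≡ᵇ-refl n

≢⇒≡ᵇ-false : ∀ {m n} → m ≢ n → (m ≡ᵇ n) ≡ false
≢⇒≡ᵇ-false {zero}  {zero}  0≢0 = ⊥-elim (0≢0 refl)
≢⇒≡ᵇ-false {zero}  {suc n} _   = refl
≢⇒≡ᵇ-false {suc m} {zero}  _   = refl
≢⇒≡ᵇ-false {suc m} {suc n} m≢n = ≢⇒≡ᵇ-false (m≢n ∘ cong suc)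

module _ (t : Term) (x : ℕ) where

  substTerm-bound : substTerm t x (var x) ≡ t
  substTerm-bound rewrite ≡ᵇ-refl x = refl

  substTerm-free : ∀ {y} → y ≢ x → substTerm t x (var y) ≡ var y
  substTerm-free y≢x rewrite ≢⇒≡ᵇ-false y≢x = refl

  subst-all-bound : ∀ B → subst t x (all x B) ≡ all x B
  subst-all-bound B rewrite ≡ᵇ-refl x = refl

  subst-ex-bound : ∀ B → subst t x (ex x B) ≡ ex x B
  subst-ex-bound B rewrite ≡ᵇ-refl x = refl

  subst-all-free : ∀ {y} B → y ≢ x → subst t x (all y B) ≡ all y (subst t x B)
  subst-all-free B y≢x rewrite ≢⇒≡ᵇ-false y≢x = refl

  subst-ex-free : ∀ {y} B → y ≢ x → subst t x (ex y B) ≡ ex y (subst t x B)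
  subst-ex-free B y≢x rewrite ≢⇒≡ᵇ-false y≢x = refl

  map-substTerm-nonfree : ∀ ts → var x ∉ ts → map (substTerm t x) ts ≡ ts
  map-substTerm-nonfree []            _  = refl
  map-substTerm-nonfree (con c ∷ ts)  x∉ = cong (con c ∷_) (map-substTerm-nonfree ts (x∉ ∘ there))
  map-substTerm-nonfree (var y ∷ ts)  x∉ with y ≟ x
  ... | yes refl = ⊥-elim (x∉ (here refl))
  ... | no y≢x   = cong₂ _∷_ (substTerm-free y≢x) (map-substTerm-nonfree ts (x∉ ∘ there))

  subst-nonfree : ∀ B → ¬ ParIn (var x) B → subst t x B ≡ B
  subst-nonfree ⊤'         _  = refl
  subst-nonfree ⊥'         _  = refl
  subst-nonfree (rel r ts) x∉ = cong (rel r) (map-substTerm-nonfree ts (x∉ ∘ pRel))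
  subst-nonfree (and B C)  x∉ = cong₂ and (subst-nonfree B (x∉ ∘ pAndL)) (subst-nonfree C (x∉ ∘ pAndR))
  subst-nonfree (or B C)   x∉ = cong₂ or (subst-nonfree B (x∉ ∘ pOrL)) (subst-nonfree C (x∉ ∘ pOrR))
  subst-nonfree (imp B C)  x∉ = cong₂ imp (subst-nonfree B (x∉ ∘ pImpL)) (subst-nonfree C (x∉ ∘ pImpR))
  subst-nonfree (all y B)  x∉ with y ≟ x
  ... | yes refl = subst-all-bound B
  ... | no y≢x   = trans (subst-all-free B y≢x) (cong (all y) (subst-nonfree B (λ p → x∉ (pAllV p (≢-sym y≢x)))))
  subst-nonfree (ex y B)   x∉ with y ≟ x
  ... | yes refl = subst-ex-bound B
  ... | no y≢x   = trans (subst-ex-free B y≢x) (cong (ex y) (subst-nonfree B (λ p → x∉ (pExV p (≢-sym y≢x)))))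

renderBinary : Symbol → Formula → Formula → List Symbol
renderBinary s B C = sLP ∷ render B ++ (s ∷ render C ++ [ sRP ])

length-renderBinary : ∀ s B C → length (renderBinary s B C) ≡ 3 + (len B + len C)
length-renderBinary s B C =
  trans (cong suc (trans (length-++ (render B)) (cong (λ n → len B + suc n) (length-++ (render C)))))
        (rearrange (len B) (len C))
  where
  rearrange : ∀ b c → suc (b + suc (c + 1)) ≡ 3 + (b + c)
  rearrange = solve-∀

len+len<renderBinary : ∀ s B C → len B + len C < length (renderBinary s B C)
len+len<renderBinary s B C rewrite length-renderBinary s B C = s≤s (m≤n⇒m≤1+n (m≤n⇒m≤1+n ≤-refl))

len-pos : ∀ A → 0 < len A
len-pos ⊤'        = z<s
len-pos ⊥'        = z<s
len-pos (rel _ _) = z<s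
len-pos (and _ _) = z<s
len-pos (or _ _)  = z<s
len-pos (imp _ _) = z<s
len-pos (all _ _) = z<s
len-pos (ex _ _)  = z<s

length-renderArgsTail-map : ∀ f ts → length (renderArgsTail (map f ts)) ≡ length (renderArgsTail ts)
length-renderArgsTail-map f []       = refl
length-renderArgsTail-map f (_ ∷ ts) = cong (suc ∘ suc) (length-renderArgsTail-map f ts)

length-renderArgs-map : ∀ f ts → length (renderArgs (map f ts)) ≡ length (renderArgs ts)
length-renderArgs-map f []       = refl
length-renderArgs-map f (_ ∷ ts) = cong (suc ∘ suc) (length-renderArgsTail-map f ts)

length≤length-renderArgsTail : ∀ ts → length ts ≤ length (renderArgsTail ts)
length≤length-renderArgsTail []       = z≤n
length≤length-renderArgsTail (_ ∷ ts) = m≤n⇒m≤1+n (s≤s (length≤length-renderArgsTail ts))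

len-subst : ∀ t x B → len (subst t x B) ≡ len B
len-subst t x ⊤'         = refl
len-subst t x ⊥'         = refl
len-subst t x (rel r ts) = cong suc (length-renderArgs-map (substTerm t x) ts)
len-subst t x (and B C) rewrite length-renderBinary sAnd (subst t x B) (subst t x C) | length-renderBinary sAnd B C
  = cong₂ (λ b c → 3 + (b + c)) (len-subst t x B) (len-subst t x C)
len-subst t x (or B C) rewrite length-renderBinary sOr (subst t x B) (subst t x C) | length-renderBinary sOr B C
  = cong₂ (λ b c → 3 + (b + c)) (len-subst t x B) (len-subst t x C)
len-subst t x (imp B C) rewrite length-renderBinary sImp (subst t x B) (subst t x C) | length-renderBinary sImp B C
  = cong₂ (λ b c → 3 + (b + c)) (len-subst t x B) (len-subst t x C)
len-subst t x (all y B) with y ≟ x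
... | yes refl rewrite subst-all-bound t y B = refl
... | no y≢x   rewrite subst-all-free t x B y≢x = cong (suc ∘ suc) (len-subst t x B)
len-subst t x (ex y B) with y ≟ x
... | yes refl rewrite subst-ex-bound t y B = refl
... | no y≢x   rewrite subst-ex-free t x B y≢x = cong (suc ∘ suc) (len-subst t x B)

qd-subst : ∀ t x B → qd (subst t x B) ≡ qd B
qd-subst t x ⊤'        = refl
qd-subst t x ⊥'        = refl
qd-subst t x (rel _ _) = refl
qd-subst t x (and B C) = cong₂ _⊔_ (qd-subst t x B) (qd-subst t x C)
qd-subst t x (or B C)  = cong₂ _⊔_ (qd-subst t x B) (qd-subst t x C)
qd-subst t x (imp B C) = cong₂ _⊔_ (qd-subst t x B) (qd-subst t x C)
qd-subst t x (all y B) with y ≟ x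
... | yes refl rewrite subst-all-bound t y B = refl
... | no y≢x   rewrite subst-all-free t x B y≢x = cong suc (qd-subst t x B)
qd-subst t x (ex y B) with y ≟ x
... | yes refl rewrite subst-ex-bound t y B = refl
... | no y≢x   rewrite subst-ex-free t x B y≢x = cong suc (qd-subst t x B)

occurrences : Formula → List Term
occurrences ⊤'         = []
occurrences ⊥'         = []
occurrences (rel _ ts) = ts
occurrences (and B C)  = occurrences B ++ occurrences C
occurrences (or B C)   = occurrences B ++ occurrences C
occurrences (imp B C)  = occurrences B ++ occurrences C
occurrences (all _ B)  = occurrences B
occurrences (ex _ B)   = occurrences B

parameter-occurs : ∀ {t A} → ParIn t A → t ∈ occurrences A
parameter-occurs (pRel t∈)                  = t∈
parameter-occurs (pAndL p)                  = ∈-++⁺ˡ (parameter-occurs p)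
parameter-occurs {A = and B _} (pAndR p)    = ∈-++⁺ʳ (occurrences B) (parameter-occurs p)
parameter-occurs (pOrL p)                   = ∈-++⁺ˡ (parameter-occurs p)
parameter-occurs {A = or B _} (pOrR p)      = ∈-++⁺ʳ (occurrences B) (parameter-occurs p)
parameter-occurs (pImpL p)                  = ∈-++⁺ˡ (parameter-occurs p)
parameter-occurs {A = imp B _} (pImpR p)    = ∈-++⁺ʳ (occurrences B) (parameter-occurs p)
parameter-occurs (pAllC p)                  = parameter-occurs p
parameter-occurs (pAllV p _)                = parameter-occurs p
parameter-occurs (pExC p)                   = parameter-occurs p
parameter-occurs (pExV p _)                 = parameter-occurs p

isPFormula? : ∀ Ps B → Dec (IsPFormula (_∈ Ps) B)
isPFormula? Ps B = map′ (λ h t p → All.lookup h (parameter-occurs p) p) (λ h → All.tabulate λ {t} _ → h t)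
  (all? (λ t → parIn? t B →-dec t ∈? Ps) (occurrences B))

occurrences-budget-++ : ∀ {a b m n} (os ps : List Term) → a + a + length os ≤ m → b + b + length ps ≤ n →
                        (a ⊔ b) + (a ⊔ b) + length (os ++ ps) ≤ m + n
occurrences-budget-++ {a} {b} {m} {n} os ps ha hb = begin
  (a ⊔ b) + (a ⊔ b) + length (os ++ ps)     ≡⟨ cong ((a ⊔ b) + (a ⊔ b) +_) (length-++ os) ⟩
  (a ⊔ b) + (a ⊔ b) + (length os + length ps) ≤⟨ +-monoˡ-≤ _ (+-mono-≤ (m⊔n≤m+n a b) (m⊔n≤m+n a b)) ⟩
  (a + b) + (a + b) + (length os + length ps) ≡⟨ interchange a b (length os) (length ps) ⟩
  (a + a + length os) + (b + b + length ps)   ≤⟨ +-mono-≤ ha hb ⟩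
  m + n                                       ∎
  where
  open ≤-Reasoning
  interchange : ∀ a b o p → (a + b) + (a + b) + (o + p) ≡ (a + a + o) + (b + b + p)
  interchange = solve-∀

binary-budget : ∀ s B C → qd B + qd B + length (occurrences B) ≤ len B → qd C + qd C + length (occurrences C) ≤ len C →
                (qd B ⊔ qd C) + (qd B ⊔ qd C) + length (occurrences B ++ occurrences C) ≤ length (renderBinary s B C)
binary-budget s B C hB hC =
  ≤-trans (occurrences-budget-++ {qd B} {qd C} (occurrences B) _ hB hC) (<⇒≤ (len+len<renderBinary s B C))

quantifier-budget : ∀ q o l → q + q + o ≤ l → suc q + suc q + o ≤ suc (suc l)
quantifier-budget q _ _ h rewrite +-suc q q = s≤s (s≤s h)

occurrences-budget : ∀ A → qd A + qd A + length (occurrences A) ≤ len A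
occurrences-budget ⊤'               = z≤n
occurrences-budget ⊥'               = z≤n
occurrences-budget (rel _ [])       = z≤n
occurrences-budget (rel _ (_ ∷ ts)) = s≤s (m≤n⇒m≤1+n (m≤n⇒m≤1+n (length≤length-renderArgsTail ts)))
occurrences-budget (and B C)        = binary-budget sAnd B C (occurrences-budget B) (occurrences-budget C)
occurrences-budget (or B C)         = binary-budget sOr B C (occurrences-budget B) (occurrences-budget C)
occurrences-budget (imp B C)        = binary-budget sImp B C (occurrences-budget B) (occurrences-budget C)
occurrences-budget (all _ B)        = quantifier-budget (qd B) _ _ (occurrences-budget B)
occurrences-budget (ex _ B)         = quantifier-budget (qd B) _ _ (occurrences-budget B)

occurrencesIn : List Formula → List Term
occurrencesIn = concatMap occurrences

occurrencesIn-budget : ∀ S → maxQd S + maxQd S + length (occurrencesIn S) ≤ totalLen S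
occurrencesIn-budget []      = z≤n
occurrencesIn-budget (A ∷ S) =
  occurrences-budget-++ {qd A} {maxQd S} (occurrences A) _ (occurrences-budget A) (occurrencesIn-budget S)

-- Unfolding a formula over a set of terms

subformula-trans : ∀ {X Y Z} → SubFormula X Y → SubFormula Y Z → SubFormula X Z
subformula-trans sfSelf        q = q
subformula-trans (sfAndL p)    q = sfAndL (subformula-trans p q)
subformula-trans (sfAndR p)    q = sfAndR (subformula-trans p q)
subformula-trans (sfOrL p)     q = sfOrL (subformula-trans p q)
subformula-trans (sfOrR p)     q = sfOrR (subformula-trans p q)
subformula-trans (sfImpL p)    q = sfImpL (subformula-trans p q)
subformula-trans (sfImpR p)    q = sfImpR (subformula-trans p q)
subformula-trans (sfAll t p s) q = sfAll t (subformula-trans p q) s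
subformula-trans (sfEx t p s)  q = sfEx t (subformula-trans p q) s

module Descendants (Ps : List Term) where

  data Step : Formula → Formula → Set where
    andˡ : ∀ {B C} → Step (and B C) B
    andʳ : ∀ {B C} → Step (and B C) C
    orˡ  : ∀ {B C} → Step (or B C) B
    orʳ  : ∀ {B C} → Step (or B C) C
    impˡ : ∀ {B C} → Step (imp B C) B
    impʳ : ∀ {B C} → Step (imp B C) C
    allᵗ : ∀ {x B t} → t ∈ Ps → Substitutable t x B → Step (all x B) (subst t x B)
    exᵗ  : ∀ {x B t} → t ∈ Ps → Substitutable t x B → Step (ex x B) (subst t x B)

  step-subformula : ∀ {A Z} → Step A Z → SubFormula Z A
  step-subformula andˡ                  = sfAndL sfSelf
  step-subformula andʳ                  = sfAndR sfSelf
  step-subformula orˡ                   = sfOrL sfSelf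
  step-subformula orʳ                   = sfOrR sfSelf
  step-subformula impˡ                  = sfImpL sfSelf
  step-subformula impʳ                  = sfImpR sfSelf
  step-subformula (allᵗ {t = t} _ sub)  = sfAll t sfSelf sub
  step-subformula (exᵗ {t = t} _ sub)   = sfEx t sfSelf sub

  step-len< : ∀ {A Z} → Step A Z → len Z < len A
  step-len< {and B C} andˡ           = ≤-<-trans (m≤m+n (len B) (len C)) (len+len<renderBinary sAnd B C)
  step-len< {and B C} andʳ           = ≤-<-trans (m≤n+m (len C) (len B)) (len+len<renderBinary sAnd B C)
  step-len< {or B C}  orˡ            = ≤-<-trans (m≤m+n (len B) (len C)) (len+len<renderBinary sOr B C)
  step-len< {or B C}  orʳ            = ≤-<-trans (m≤n+m (len C) (len B)) (len+len<renderBinary sOr B C)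
  step-len< {imp B C} impˡ           = ≤-<-trans (m≤m+n (len B) (len C)) (len+len<renderBinary sImp B C)
  step-len< {imp B C} impʳ           = ≤-<-trans (m≤n+m (len C) (len B)) (len+len<renderBinary sImp B C)
  step-len< {all x B} (allᵗ {t = t} _ _) = s≤s (≤-trans (≤-reflexive (len-subst t x B)) (n≤1+n _))
  step-len< {ex x B}  (exᵗ {t = t} _ _)  = s≤s (≤-trans (≤-reflexive (len-subst t x B)) (n≤1+n _))

  instances : ℕ → Formula → List Formula
  instances x B = map (λ t → subst t x B) (filter (λ t → substitutable? t x B) Ps)

  children : Formula → List Formula
  children (and B C) = B ∷ [ C ]
  children (or B C)  = B ∷ [ C ]
  children (imp B C) = B ∷ [ C ]
  children (all x B) = instances x B
  children (ex x B)  = instances x B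
  children _         = []

  ∈-instances⁺ : ∀ {x B t} → t ∈ Ps → Substitutable t x B → subst t x B ∈ instances x B
  ∈-instances⁺ {x} {B} t∈ sub = ∈-map⁺ (λ t → subst t x B) (∈-filter⁺ (λ t → substitutable? t x B) t∈ sub)

  ∈-instances⁻ : ∀ {x B Z} → Z ∈ instances x B → ∃[ t ] t ∈ Ps × Substitutable t x B × Z ≡ subst t x B
  ∈-instances⁻ {x} {B} Z∈ with t , t∈ , refl ← ∈-map⁻ (λ t → subst t x B) Z∈ =
    let t∈Ps , sub = ∈-filter⁻ (λ t → substitutable? t x B) t∈ in t , t∈Ps , sub , refl

  length-instances : ∀ x B → length (instances x B) ≤ length Ps
  length-instances x B = begin
    length (instances x B)                                ≡⟨ length-map (λ t → subst t x B) (filter substitutable Ps) ⟩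
    length (filter substitutable Ps) ≤⟨ length-filter substitutable Ps ⟩
    length Ps                                             ∎
    where
    open ≤-Reasoning
    substitutable = λ t → substitutable? t x B

  children⁺ : ∀ {A Z} → Step A Z → Z ∈ children A
  children⁺ andˡ           = here refl
  children⁺ andʳ           = there (here refl)
  children⁺ orˡ            = here refl
  children⁺ orʳ            = there (here refl)
  children⁺ impˡ           = here refl
  children⁺ impʳ           = there (here refl)
  children⁺ (allᵗ t∈ sub)  = ∈-instances⁺ t∈ sub
  children⁺ (exᵗ t∈ sub)   = ∈-instances⁺ t∈ sub

  children⁻ : ∀ {A Z} → Z ∈ children A → Step A Z
  children⁻ {and _ _} (here refl)         = andˡ
  children⁻ {and _ _} (there (here refl)) = andʳ
  children⁻ {or _ _}  (here refl)         = orˡ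
  children⁻ {or _ _}  (there (here refl)) = orʳ
  children⁻ {imp _ _} (here refl)         = impˡ
  children⁻ {imp _ _} (there (here refl)) = impʳ
  children⁻ {all _ _} Z∈ with _ , t∈ , sub , refl ← ∈-instances⁻ Z∈ = allᵗ t∈ sub
  children⁻ {ex _ _}  Z∈ with _ , t∈ , sub , refl ← ∈-instances⁻ Z∈ = exᵗ t∈ sub

  -- k bounds the depth of the unfolding; k = len A unfolds completely, as every step shortens the formula.
  descendants : ℕ → Formula → List Formula
  descendants zero    A = [ A ]
  descendants (suc k) A = A ∷ concatMap (descendants k) (children A)

  self∈descendants : ∀ k A → A ∈ descendants k A
  self∈descendants zero    _ = here refl
  self∈descendants (suc k) _ = here refl

  ∈-descendants⁺ : ∀ {k A Z X} → Step A Z → X ∈ descendants k Z → X ∈ descendants (suc k) A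
  ∈-descendants⁺ {k} step X∈ = there (∈-concatMap⁺ (descendants k) (lose (children⁺ step) X∈))

  ∈-descendants⁻ : ∀ {k A X} → X ∈ descendants (suc k) A → X ≡ A ⊎ ∃[ Z ] Step A Z × X ∈ descendants k Z
  ∈-descendants⁻ (here refl) = inj₁ refl
  ∈-descendants⁻ {k} {A} (there X∈) with Z , Z∈ , X∈Z ← find (∈-concatMap⁻ (descendants k) {children A} X∈) =
    inj₂ (Z , children⁻ Z∈ , X∈Z)

  descendants-subformula : ∀ {k A X} → X ∈ descendants k A → SubFormula X A
  descendants-subformula {zero} (here refl) = sfSelf
  descendants-subformula {suc k} X∈ with ∈-descendants⁻ X∈
  ... | inj₁ refl              = sfSelf
  ... | inj₂ (_ , step , X∈Z) = subformula-trans (descendants-subformula X∈Z) (step-subformula step)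

  descendants-len≤ : ∀ {k A X} → X ∈ descendants k A → len X ≤ len A
  descendants-len≤ {zero} (here refl) = ≤-refl
  descendants-len≤ {suc k} X∈ with ∈-descendants⁻ X∈
  ... | inj₁ refl              = ≤-refl
  ... | inj₂ (_ , step , X∈Z) = ≤-trans (descendants-len≤ X∈Z) (<⇒≤ (step-len< step))

  descendants-⊆ : ∀ {k A X} → len A ≤ k → X ∈ descendants k A →
                  ∃[ j ] len X ≤ j × descendants j X ⊆ descendants k A
  descendants-⊆ {zero} lenA≤0 (here refl) = zero , lenA≤0 , id
  descendants-⊆ {suc k} lenA≤k X∈ with ∈-descendants⁻ X∈
  ... | inj₁ refl              = suc k , lenA≤k , id
  ... | inj₂ (_ , step , X∈Z) with j , lenX≤j , ⊆Z ← descendants-⊆ (≤-pred (≤-trans (step-len< step) lenA≤k)) X∈Z =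
    j , lenX≤j , ∈-descendants⁺ step ∘ ⊆Z

  descendants-step : ∀ {k A X Y} → len A ≤ k → X ∈ descendants k A → Step X Y → Y ∈ descendants k A
  descendants-step lenA≤k X∈ step with descendants-⊆ lenA≤k X∈
  ... | zero  , lenX≤0 , _  = ⊥-elim (n≮0 (≤-trans (step-len< step) lenX≤0))
  ... | suc j , _      , ⊆A = ⊆A (∈-descendants⁺ step (self∈descendants j _))

  module _ .{{_ : NonZero (length Ps)}} where

    private
      p = length Ps

    LengthBound : ℕ → Set
    LengthBound k = ∀ A → length (descendants k A) ≤ len A * p ^ qd A

    binary-count : ∀ {k} s B C → LengthBound k →
                   suc (length (concatMap (descendants k) (B ∷ [ C ]))) ≤ length (renderBinary s B C) * p ^ (qd B ⊔ qd C)
    binary-count {k} s B C bound = begin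
      suc (length (concatMap (descendants k) (B ∷ [ C ]))) ≡⟨ cong suc (length-concatMap (descendants k) (B ∷ [ C ])) ⟩
      suc (length (descendants k B) + (length (descendants k C) + 0))
        ≤⟨ s≤s (+-mono-≤ (raise B (m≤m⊔n (qd B) (qd C))) (+-monoˡ-≤ 0 (raise C (m≤n⊔m (qd B) (qd C))))) ⟩
      suc (len B * P + (len C * P + 0))                    ≡⟨ cong (λ n → suc (len B * P + n)) (+-identityʳ _) ⟩
      suc (len B * P + len C * P)                          ≡⟨ cong suc (*-distribʳ-+ P (len B) (len C)) ⟨
      suc ((len B + len C) * P)
        ≤⟨ m<n⇒1+m*o≤n*o (m^n>0 p (qd B ⊔ qd C)) (len+len<renderBinary s B C) ⟩
      length (renderBinary s B C) * P                      ∎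
      where
      open ≤-Reasoning
      P = p ^ (qd B ⊔ qd C)
      raise : ∀ A → qd A ≤ qd B ⊔ qd C → length (descendants k A) ≤ len A * P
      raise A qd≤ = ≤-trans (bound A) (*-monoʳ-≤ (len A) (^-monoʳ-≤ p qd≤))

    quantifier-count : ∀ {k} x B → LengthBound k →
                       suc (length (concatMap (descendants k) (instances x B))) ≤ suc (suc (len B)) * p ^ suc (qd B)
    quantifier-count {k} x B bound = begin
      suc (length (concatMap (descendants k) (instances x B)))
        ≡⟨ cong suc (length-concatMap (descendants k) (instances x B)) ⟩
      suc (sum (map (length ∘ descendants k) (instances x B)))   ≤⟨ s≤s (sum-map-≤ (instances x B) instance-count) ⟩
      suc (length (instances x B) * (len B * q))                 ≤⟨ s≤s (*-monoˡ-≤ (len B * q) (length-instances x B)) ⟩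
      suc (p * (len B * q))                                      ≡⟨ cong suc (left-comm p (len B) q) ⟩
      suc (len B * (p * q))
        ≤⟨ m<n⇒1+m*o≤n*o (m^n>0 p (suc (qd B))) (m<n⇒m<1+n (n<1+n (len B))) ⟩
      suc (suc (len B)) * (p * q)                                ∎
      where
      open ≤-Reasoning
      q = p ^ qd B
      left-comm : ∀ a b c → a * (b * c) ≡ b * (a * c)
      left-comm = solve-∀
      instance-count : ∀ {Z} → Z ∈ instances x B → length (descendants k Z) ≤ len B * q
      instance-count Z∈ with t , _ , _ , refl ← ∈-instances⁻ Z∈ =
        ≤-trans (bound _) (≤-reflexive (cong₂ (λ l d → l * p ^ d) (len-subst t x B) (qd-subst t x B)))

    length-descendants : ∀ k → LengthBound k
    length-descendants zero    A          = *-mono-≤ (len-pos A) (m^n>0 p (qd A))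
    length-descendants (suc k) ⊤'         = length-descendants zero ⊤'
    length-descendants (suc k) ⊥'         = length-descendants zero ⊥'
    length-descendants (suc k) (rel r ts) = length-descendants zero (rel r ts)
    length-descendants (suc k) (and B C)  = binary-count {k} sAnd B C (length-descendants k)
    length-descendants (suc k) (or B C)   = binary-count {k} sOr B C (length-descendants k)
    length-descendants (suc k) (imp B C)  = binary-count {k} sImp B C (length-descendants k)
    length-descendants (suc k) (all x B)  = quantifier-count {k} x B (length-descendants k)
    length-descendants (suc k) (ex x B)   = quantifier-count {k} x B (length-descendants k)

-- Completeness of the unfolding

Unbound : List ℕ → Term → Set
Unbound Γ (var y) = y ∉ Γ
Unbound Γ (con _) = ⊤

unbound-[] : ∀ t → Unbound [] t
unbound-[] (var _) = λ ()
unbound-[] (con _) = tt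

unbound-⊆ : ∀ {Γ Δ} → Δ ⊆ Γ → ∀ t → Unbound Γ t → Unbound Δ t
unbound-⊆ Δ⊆Γ (var _) y∉Γ = y∉Γ ∘ Δ⊆Γ
unbound-⊆ _   (con _) _   = tt

unbound-∷ : ∀ {Γ y} t → t ≢ var y → Unbound Γ t → Unbound (y ∷ Γ) t
unbound-∷ (var _) t≢y _   (here refl)  = t≢y refl
unbound-∷ (var _) _   z∉Γ (there z∈Γ) = z∉Γ z∈Γ
unbound-∷ (con _) _   _                = tt

all-parameter : ∀ {Γ x B} t → ParIn t B → Unbound (x ∷ Γ) t → ParIn t (all x B) × Unbound Γ t
all-parameter (var _) p u = pAllV p (u ∘ here) , u ∘ there
all-parameter (con _) p _ = pAllC p , tt

ex-parameter : ∀ {Γ x B} t → ParIn t B → Unbound (x ∷ Γ) t → ParIn t (ex x B) × Unbound Γ t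
ex-parameter (var _) p u = pExV p (u ∘ here) , u ∘ there
ex-parameter (con _) p _ = pExC p , tt

module Completeness (Ps : List Term) {c : ℕ} (c∈Ps : con c ∈ Ps) where

  open Descendants Ps

  -- A Ps-formula may be reachable only through instances by terms outside Ps (⊤ via
  -- R(t) ∧ ⊤ from ∀x (R(x) ∧ ⊤)).  Approx Γ B B° says that B° is B with some free
  -- occurrences of terms outside Ps replaced by c, Γ listing the variables bound above;
  -- steps from B are matched by steps of the unfolding from B° (approx-subst), and a
  -- Ps-formula equals each of its approximations (approx-exact).
  TermApprox : List ℕ → Term → Term → Set
  TermApprox Γ t u = t ≡ u ⊎ (t ∉ Ps × u ≡ con c × Unbound Γ t)

  data Approx : List ℕ → Formula → Formula → Set where
    ⊤ᵃ   : ∀ {Γ} → Approx Γ ⊤' ⊤'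
    ⊥ᵃ   : ∀ {Γ} → Approx Γ ⊥' ⊥'
    relᵃ : ∀ {Γ r ts us} → Pointwise (TermApprox Γ) ts us → Approx Γ (rel r ts) (rel r us)
    andᵃ : ∀ {Γ B C B° C°} → Approx Γ B B° → Approx Γ C C° → Approx Γ (and B C) (and B° C°)
    orᵃ  : ∀ {Γ B C B° C°} → Approx Γ B B° → Approx Γ C C° → Approx Γ (or B C) (or B° C°)
    impᵃ : ∀ {Γ B C B° C°} → Approx Γ B B° → Approx Γ C C° → Approx Γ (imp B C) (imp B° C°)
    allᵃ : ∀ {Γ x B B°} → Approx (x ∷ Γ) B B° → Approx Γ (all x B) (all x B°)
    exᵃ  : ∀ {Γ x B B°} → Approx (x ∷ Γ) B B° → Approx Γ (ex x B) (ex x B°)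

  approx-refl : ∀ {Γ} A → Approx Γ A A
  approx-refl ⊤'         = ⊤ᵃ
  approx-refl ⊥'         = ⊥ᵃ
  approx-refl (rel _ _)  = relᵃ (Pointwise.refl (inj₁ refl))
  approx-refl (and B C)  = andᵃ (approx-refl B) (approx-refl C)
  approx-refl (or B C)   = orᵃ (approx-refl B) (approx-refl C)
  approx-refl (imp B C)  = impᵃ (approx-refl B) (approx-refl C)
  approx-refl (all _ B)  = allᵃ (approx-refl B)
  approx-refl (ex _ B)   = exᵃ (approx-refl B)

  approx-⊆ : ∀ {Γ Δ A B} → Δ ⊆ Γ → Approx Γ A B → Approx Δ A B
  approx-⊆ _    ⊤ᵃ         = ⊤ᵃ
  approx-⊆ _    ⊥ᵃ         = ⊥ᵃ
  approx-⊆ Δ⊆Γ (relᵃ ts≈us) = relᵃ (Pointwise.map weaken ts≈us)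
    where
    weaken : ∀ {t u} → TermApprox _ t u → TermApprox _ t u
    weaken (inj₁ t≡u)              = inj₁ t≡u
    weaken (inj₂ (t∉ , u≡c , t-ub)) = inj₂ (t∉ , u≡c , unbound-⊆ Δ⊆Γ _ t-ub)
  approx-⊆ Δ⊆Γ (andᵃ a b) = andᵃ (approx-⊆ Δ⊆Γ a) (approx-⊆ Δ⊆Γ b)
  approx-⊆ Δ⊆Γ (orᵃ a b)  = orᵃ (approx-⊆ Δ⊆Γ a) (approx-⊆ Δ⊆Γ b)
  approx-⊆ Δ⊆Γ (impᵃ a b) = impᵃ (approx-⊆ Δ⊆Γ a) (approx-⊆ Δ⊆Γ b)
  approx-⊆ Δ⊆Γ (allᵃ a)   = allᵃ (approx-⊆ (∷⁺ʳ _ Δ⊆Γ) a)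
  approx-⊆ Δ⊆Γ (exᵃ a)    = exᵃ (approx-⊆ (∷⁺ʳ _ Δ⊆Γ) a)

  pointwise-var : ∀ {Γ ts us z} → Pointwise (TermApprox Γ) ts us → var z ∈ us → var z ∈ ts
  pointwise-var (inj₁ refl ∷ _)              (here z≡u) = here z≡u
  pointwise-var (inj₂ (_ , refl , _) ∷ _)    (here ())
  pointwise-var (_ ∷ ts≈us)                 (there z∈) = there (pointwise-var ts≈us z∈)

  approx-var : ∀ {Γ A B z} → Approx Γ A B → ParIn (var z) B → ParIn (var z) A
  approx-var (relᵃ ts≈us) (pRel z∈)   = pRel (pointwise-var ts≈us z∈)
  approx-var (andᵃ a _)   (pAndL p)   = pAndL (approx-var a p)
  approx-var (andᵃ _ b)   (pAndR p)   = pAndR (approx-var b p)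
  approx-var (orᵃ a _)    (pOrL p)    = pOrL (approx-var a p)
  approx-var (orᵃ _ b)    (pOrR p)    = pOrR (approx-var b p)
  approx-var (impᵃ a _)   (pImpL p)   = pImpL (approx-var a p)
  approx-var (impᵃ _ b)   (pImpR p)   = pImpR (approx-var b p)
  approx-var (allᵃ a)     (pAllV p n) = pAllV (approx-var a p) n
  approx-var (exᵃ a)      (pExV p n)  = pExV (approx-var a p) n

  pointwise-exact : ∀ {Γ ts us} → Pointwise (TermApprox Γ) ts us → (∀ {t} → t ∈ ts → Unbound Γ t → t ∈ Ps) → ts ≡ us
  pointwise-exact []                         _    = refl
  pointwise-exact (inj₁ refl ∷ ts≈us)         inPs = cong (_ ∷_) (pointwise-exact ts≈us (inPs ∘ there))
  pointwise-exact (inj₂ (t∉ , _ , t-ub) ∷ _) inPs = ⊥-elim (t∉ (inPs (here refl) t-ub))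

  approx-exact : ∀ {Γ B B°} → Approx Γ B B° → (∀ t → ParIn t B → Unbound Γ t → t ∈ Ps) → B ≡ B°
  approx-exact ⊤ᵃ                 _    = refl
  approx-exact ⊥ᵃ                 _    = refl
  approx-exact (relᵃ {r = r} ts≈us) inPs = cong (rel r) (pointwise-exact ts≈us (inPs _ ∘ pRel))
  approx-exact (andᵃ a b) inPs = cong₂ and (approx-exact a (λ t → inPs t ∘ pAndL)) (approx-exact b (λ t → inPs t ∘ pAndR))
  approx-exact (orᵃ a b)  inPs = cong₂ or (approx-exact a (λ t → inPs t ∘ pOrL)) (approx-exact b (λ t → inPs t ∘ pOrR))
  approx-exact (impᵃ a b) inPs = cong₂ imp (approx-exact a (λ t → inPs t ∘ pImpL)) (approx-exact b (λ t → inPs t ∘ pImpR))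
  approx-exact (allᵃ {x = x} a) inPs = cong (all x) (approx-exact a λ t p t-ub → uncurry (inPs t) (all-parameter t p t-ub))
  approx-exact (exᵃ {x = x} a)  inPs = cong (ex x) (approx-exact a λ t p t-ub → uncurry (inPs t) (ex-parameter t p t-ub))

  Instance : Term → Term → Set
  Instance t t° = t° ≡ t ⊎ (t ∉ Ps × t° ≡ con c)

  instance-in-Ps : ∀ t → ∃[ t° ] t° ∈ Ps × Instance t t°
  instance-in-Ps t with t ∈? Ps
  ... | yes t∈ = t , t∈ , inj₁ refl
  ... | no t∉  = con c , c∈Ps , inj₂ (t∉ , refl)

  instance-≢ : ∀ {t t° y} → Instance t t° → t ≢ var y → t° ≢ var y
  instance-≢ (inj₁ refl)      t≢y = t≢y
  instance-≢ (inj₂ (_ , refl)) _   = λ ()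

  instance-approx : ∀ {Γ t t°} → Instance t t° → Unbound Γ t → TermApprox Γ t t°
  instance-approx (inj₁ refl)       _    = inj₁ refl
  instance-approx (inj₂ (t∉ , t°≡c)) t-ub = inj₂ (t∉ , t°≡c , t-ub)

  termApprox-subst : ∀ {Δ x t t° s u} → Instance t t° → TermApprox (Δ ++ [ x ]) s u → (s ≡ var x → Unbound Δ t) →
                     TermApprox Δ (substTerm t x s) (substTerm t° x u)
  termApprox-subst {s = con _} _ (inj₁ refl)              _ = inj₁ refl
  termApprox-subst {s = con _} _ (inj₂ (s∉ , refl , _))   _ = inj₂ (s∉ , refl , tt)
  termApprox-subst {x = x} {t} {t°} {var y} ins (inj₁ refl) t-ub with y ≟ x
  ... | yes refl rewrite substTerm-bound t y | substTerm-bound t° y = instance-approx ins (t-ub refl)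
  ... | no y≢x   rewrite substTerm-free t x y≢x | substTerm-free t° x y≢x = inj₁ refl
  termApprox-subst {Δ} {x} {t} {s = var y} _ (inj₂ (s∉ , refl , y∉)) _ with y ≟ x
  ... | yes refl = ⊥-elim (y∉ (∈-++⁺ʳ Δ (here refl)))
  ... | no y≢x   rewrite substTerm-free t x y≢x = inj₂ (s∉ , refl , y∉ ∘ ∈-++⁺ˡ)

  pointwise-subst : ∀ {Δ x t t° ts us} → Instance t t° → Pointwise (TermApprox (Δ ++ [ x ])) ts us →
                    (var x ∈ ts → Unbound Δ t) →
                    Pointwise (TermApprox Δ) (map (substTerm t x) ts) (map (substTerm t° x) us)
  pointwise-subst _   []            _    = []
  pointwise-subst ins (s≈u ∷ ts≈us) t-ub =
    termApprox-subst ins s≈u (t-ub ∘ here ∘ sym) ∷ pointwise-subst ins ts≈us (t-ub ∘ there)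

  approx-subst : ∀ {Δ x t t° B B°} → Instance t t° → Approx (Δ ++ [ x ]) B B° → Substitutable t x B →
                 (ParIn (var x) B → Unbound Δ t) → Approx Δ (subst t x B) (subst t° x B°) × Substitutable t° x B°
  approx-subst ins ⊤ᵃ _ _ = ⊤ᵃ , sbTop
  approx-subst ins ⊥ᵃ _ _ = ⊥ᵃ , sbBot
  approx-subst ins (relᵃ ts≈us) _ t-ub = relᵃ (pointwise-subst ins ts≈us (t-ub ∘ pRel)) , sbRel
  approx-subst ins (andᵃ a b) (sbAnd sa sb) t-ub =
    let a′ , sa′ = approx-subst ins a sa (t-ub ∘ pAndL); b′ , sb′ = approx-subst ins b sb (t-ub ∘ pAndR)
    in andᵃ a′ b′ , sbAnd sa′ sb′
  approx-subst ins (orᵃ a b) (sbOr sa sb) t-ub =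
    let a′ , sa′ = approx-subst ins a sa (t-ub ∘ pOrL); b′ , sb′ = approx-subst ins b sb (t-ub ∘ pOrR)
    in orᵃ a′ b′ , sbOr sa′ sb′
  approx-subst ins (impᵃ a b) (sbImp sa sb) t-ub =
    let a′ , sa′ = approx-subst ins a sa (t-ub ∘ pImpL); b′ , sb′ = approx-subst ins b sb (t-ub ∘ pImpR)
    in impᵃ a′ b′ , sbImp sa′ sb′
  approx-subst {Δ} {x} {t} {t°} ins (allᵃ {x = y} {B} {B°} a) (sbAll sub) t-ub with parIn? (var x) (all y B)
  ... | no x∉ rewrite subst-nonfree t x (all y B) x∉ | subst-nonfree t° x (all y B°) (x∉ ∘ approx-var (allᵃ a)) =
    approx-⊆ ∈-++⁺ˡ (allᵃ a) , sbAll (inj₁ (x∉ ∘ approx-var (allᵃ a)))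
  ... | yes x∈@(pAllV _ x≢y) with sub
  ...   | inj₁ x∉          = ⊥-elim (x∉ x∈)
  ...   | inj₂ (t≢y , sub′) rewrite subst-all-free t x B (≢-sym x≢y) | subst-all-free t° x B° (≢-sym x≢y) =
    let a′ , sub° = approx-subst {Δ = y ∷ Δ} {x} ins a sub′ (λ p → unbound-∷ t t≢y (t-ub (pAllV p x≢y)))
    in allᵃ a′ , sbAll (inj₂ (instance-≢ ins t≢y , sub°))
  approx-subst {Δ} {x} {t} {t°} ins (exᵃ {x = y} {B} {B°} a) (sbEx sub) t-ub with parIn? (var x) (ex y B)
  ... | no x∉ rewrite subst-nonfree t x (ex y B) x∉ | subst-nonfree t° x (ex y B°) (x∉ ∘ approx-var (exᵃ a)) =
    approx-⊆ ∈-++⁺ˡ (exᵃ a) , sbEx (inj₁ (x∉ ∘ approx-var (exᵃ a)))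
  ... | yes x∈@(pExV _ x≢y) with sub
  ...   | inj₁ x∉          = ⊥-elim (x∉ x∈)
  ...   | inj₂ (t≢y , sub′) rewrite subst-ex-free t x B (≢-sym x≢y) | subst-ex-free t° x B° (≢-sym x≢y) =
    let a′ , sub° = approx-subst {Δ = y ∷ Δ} {x} ins a sub′ (λ p → unbound-∷ t t≢y (t-ub (pExV p x≢y)))
    in exᵃ a′ , sbEx (inj₂ (instance-≢ ins t≢y , sub°))

  subformula-approx : ∀ {k A B} → len A ≤ k → SubFormula B A → ∃[ B° ] B° ∈ descendants k A × Approx [] B B°
  subformula-approx _ sfSelf = _ , self∈descendants _ _ , approx-refl _
  subformula-approx lenA≤k (sfAndL sf) with _ , X∈ , andᵃ a _ ← subformula-approx lenA≤k sf =
    _ , descendants-step lenA≤k X∈ andˡ , a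
  subformula-approx lenA≤k (sfAndR sf) with _ , X∈ , andᵃ _ b ← subformula-approx lenA≤k sf =
    _ , descendants-step lenA≤k X∈ andʳ , b
  subformula-approx lenA≤k (sfOrL sf) with _ , X∈ , orᵃ a _  ← subformula-approx lenA≤k sf =
    _ , descendants-step lenA≤k X∈ orˡ , a
  subformula-approx lenA≤k (sfOrR sf) with _ , X∈ , orᵃ _ b  ← subformula-approx lenA≤k sf =
    _ , descendants-step lenA≤k X∈ orʳ , b
  subformula-approx lenA≤k (sfImpL sf) with _ , X∈ , impᵃ a _ ← subformula-approx lenA≤k sf =
    _ , descendants-step lenA≤k X∈ impˡ , a
  subformula-approx lenA≤k (sfImpR sf) with _ , X∈ , impᵃ _ b ← subformula-approx lenA≤k sf =
    _ , descendants-step lenA≤k X∈ impʳ , b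
  subformula-approx lenA≤k (sfAll t sf sub)
    with _ , X∈ , allᵃ a ← subformula-approx lenA≤k sf | _ , t°∈ , ins ← instance-in-Ps t =
    let a° , sub° = approx-subst {Δ = []} ins a sub (λ _ → unbound-[] t)
    in _ , descendants-step lenA≤k X∈ (allᵗ t°∈ sub°) , a°
  subformula-approx lenA≤k (sfEx t sf sub)
    with _ , X∈ , exᵃ a ← subformula-approx lenA≤k sf | _ , t°∈ , ins ← instance-in-Ps t =
    let a° , sub° = approx-subst {Δ = []} ins a sub (λ _ → unbound-[] t)
    in _ , descendants-step lenA≤k X∈ (exᵗ t°∈ sub°) , a°

  subformula-descendant : ∀ {A B} → SubFormula B A → IsPFormula (_∈ Ps) B → B ∈ descendants (len A) A
  subformula-descendant sf inPs with _ , B°∈ , a ← subformula-approx ≤-refl sf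
                                with refl ← approx-exact a (λ t p _ → inPs t p) = B°∈

-- Size of the closure

candidates : List Term → List Formula → List Formula
candidates Ps = concatMap (λ A → Descendants.descendants Ps (len A) A)

len≤totalLen : ∀ {A S} → A ∈ S → len A ≤ totalLen S
len≤totalLen {S = B ∷ S} (here refl) = m≤m+n (len B) (totalLen S)
len≤totalLen {S = B ∷ S} (there A∈) = ≤-trans (len≤totalLen A∈) (m≤n+m (totalLen S) (len B))

module _ {Ps : List Term} where

  open Descendants Ps

  candidate-sound : ∀ {S B} → B ∈ candidates Ps S → ∃[ A ] A ∈ S × SubFormula B A × len B ≤ totalLen S
  candidate-sound {S} B∈ with A , A∈ , B∈A ← find (∈-concatMap⁻ (λ A → descendants (len A) A) {S} B∈) =
    A , A∈ , descendants-subformula B∈A , ≤-trans (descendants-len≤ B∈A) (len≤totalLen A∈)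

  length-candidates : .{{_ : NonZero (length Ps)}} → ∀ S {d} → maxQd S ≤ d →
                      length (candidates Ps S) ≤ totalLen S * length Ps ^ d
  length-candidates []      _    = z≤n
  length-candidates (A ∷ S) {d} qd≤d = begin
    length (descendants (len A) A ++ candidates Ps S)         ≡⟨ length-++ (descendants (len A) A) ⟩
    length (descendants (len A) A) + length (candidates Ps S)
      ≤⟨ +-mono-≤ A-count (length-candidates S (≤-trans (m≤n⊔m (qd A) _) qd≤d)) ⟩
    len A * P + totalLen S * P                                ≡⟨ *-distribʳ-+ P (len A) (totalLen S) ⟨
    (len A + totalLen S) * P                                  ∎
    where
    open ≤-Reasoning
    P = length Ps ^ d
    A-count : length (descendants (len A) A) ≤ len A * P
    A-count = ≤-trans (length-descendants (len A) A)
                      (*-monoʳ-≤ (len A) (^-monoʳ-≤ (length Ps) (≤-trans (m≤m⊔n (qd A) _) qd≤d)))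

  closure⊆candidates : ∀ {S c B} → con c ∈ Ps → (∀ {t} → ParsStar S t → t ∈ Ps) → InClosure S B → B ∈ candidates Ps S
  closure⊆candidates c∈Ps pars⊆Ps (isP , A , A∈ , sf) =
    ∈-concatMap⁺ _ (lose A∈ (Completeness.subformula-descendant Ps c∈Ps sf (λ t → pars⊆Ps ∘ isP t)))

closure-bounds : ∀ {S L Ps c} → con c ∈ Ps → (∀ {t} → ParsStar S t → t ∈ Ps) → EnumClosure S L →
                 length L ≤ totalLen S * length Ps ^ maxQd S × totalLen L ≤ totalLen S * totalLen S * length Ps ^ maxQd S
closure-bounds {S} {L} {Ps} c∈Ps pars⊆Ps (unique-L , L⇔closure) = count , total
  where
  instance _ = nonZero-length c∈Ps
  n = totalLen S
  P = length Ps ^ maxQd S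
  L⊆candidates : L ⊆ candidates Ps S
  L⊆candidates B∈L = closure⊆candidates c∈Ps pars⊆Ps (to (L⇔closure _) B∈L)
  count : length L ≤ n * P
  count = ≤-trans (unique-⊆⇒length-≤ unique-L L⊆candidates) (length-candidates S ≤-refl)
  total : totalLen L ≤ n * n * P
  total = begin
    totalLen L   ≤⟨ sum-map-≤ L (λ B∈L → let _ , _ , _ , len≤n = candidate-sound {Ps} {S} (L⊆candidates B∈L) in len≤n) ⟩
    length L * n ≤⟨ *-monoˡ-≤ n count ⟩
    n * P * n    ≡⟨ rearrange n P ⟩
    n * n * P    ∎
    where
    open ≤-Reasoning
    rearrange : ∀ a b → a * b * a ≡ a * a * b
    rearrange = solve-∀

IsConstant : Term → Set
IsConstant t = ∃[ c ] t ≡ con c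

isConstant? : ∀ t → Dec (IsConstant t)
isConstant? (var _) = no λ { (_ , ()) }
isConstant? (con c) = yes (c , refl)

pars-constant : ∀ {S Ps} → EnumPars S Ps → ∃[ c ] con c ∈ Ps
pars-constant {S} {Ps} (_ , pars⇔) with any? isConstant? Ps
... | yes has-constant with _ , t∈ , c , refl ← find has-constant = c , t∈
... | no no-constant =
  let P₀-constant-free : ¬ (∃[ c ] Pars0 S (con c))
      P₀-constant-free (c , c∈P₀) = no-constant (lose (from (pars⇔ (con c)) (inj₁ c∈P₀)) (c , refl))
  in ⊥-elim (no-constant (lose (from (pars⇔ fixedConst) (inj₂ (P₀-constant-free , refl))) (0 , refl)))

closure-enumerable : ∀ S Ps → EnumPars S Ps → Σ (List Formula) (EnumClosure S)
closure-enumerable S Ps enum@(_ , pars⇔) = L , deduplicate-! _≟ᶠ_ _ , λ B → mk⇔ (sound B) (complete B)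
  where
  L = deduplicate _≟ᶠ_ (filter (isPFormula? Ps) (candidates Ps S))
  sound : ∀ B → B ∈ L → InClosure S B
  sound B B∈L with B∈candidates , isP ← ∈-filter⁻ (isPFormula? Ps) (∈-deduplicate⁻ _≟ᶠ_ _ B∈L)
              with A , A∈ , sf , _ ← candidate-sound {Ps} {S} B∈candidates =
    (λ t → to (pars⇔ t) ∘ isP t) , A , A∈ , sf
  complete : ∀ B → InClosure S B → B ∈ L
  complete B B∈closure@(isP , _) = ∈-deduplicate⁺ _≟ᶠ_ (∈-filter⁺ (isPFormula? Ps)
    (closure⊆candidates (proj₂ (pars-constant enum)) (λ {t} → from (pars⇔ t)) B∈closure) (λ t → from (pars⇔ t) ∘ isP t))

termsOf : List Formula → List Term
termsOf S = fixedConst ∷ occurrencesIn S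

pars⊆termsOf : ∀ {S t} → ParsStar S t → t ∈ termsOf S
pars⊆termsOf (inj₁ (A , A∈ , p)) = there (∈-concatMap⁺ occurrences (lose A∈ (parameter-occurs p)))
pars⊆termsOf (inj₂ (_ , refl))   = here refl

closure-totalLen : ∀ {S L} → EnumClosure S L →
                   totalLen L ≤ totalLen S * totalLen S * suc (length (occurrencesIn S)) ^ maxQd S
closure-totalLen enumL = proj₂ (closure-bounds (here refl) pars⊆termsOf enumL)

closure-size : (S : List Formula) → Unique S → (Ps : List Term) → EnumPars S Ps →
  Σ (List Formula) λ L → EnumClosure S L
    × length L ≤ totalLen S * length Ps ^ maxQd S
    × totalLen L ≤ totalLen S * totalLen S * length Ps ^ maxQd S
closure-size S _ Ps enum@(_ , pars⇔) =
  let L , enumL = closure-enumerable S Ps enum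
  in L , enumL , closure-bounds (proj₂ (pars-constant enum)) (λ {t} → from (pars⇔ t)) enumL

closure-size-asymptotic : Σ ℕ λ N → (S : List Formula) → Unique S → N ≤ totalLen S →
  (L : List Formula) → EnumClosure S L → totalLen L * totalLen L ≤ totalLen S ^ totalLen S
closure-size-asymptotic = 64 , λ S _ 64≤n L enumL →
  let n = totalLen S
      d = maxQd S
      p = suc (length (occurrencesIn S))
      budget : p + (d + d) ≤ suc n
      budget = s≤s (≤-trans (≤-reflexive (+-comm (length (occurrencesIn S)) (d + d))) (occurrencesIn-budget S))
  in begin
    totalLen L * totalLen L             ≤⟨ *-mono-≤ (closure-totalLen enumL) (closure-totalLen enumL) ⟩
    (n * n * p ^ d) * (n * n * p ^ d)   ≡⟨ square n (p ^ d) ⟩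
    n * n * (n * n) * (p ^ d * p ^ d)   ≡⟨ cong (n * n * (n * n) *_) (^-distribˡ-+-* p d d) ⟨
    n * n * (n * n) * p ^ (d + d)       ≤⟨ power-bound {n} {p} {d + d} 64≤n z<s budget ⟩
    n ^ n                               ∎
  where
  open ≤-Reasoning
  square : ∀ a b → (a * a * b) * (a * a * b) ≡ a * a * (a * a) * (b * b)
  square = solve-∀

closure-size-polynomial : (D : ℕ) → Σ ℕ λ c → Σ ℕ λ k → (S : List Formula) → Unique S →
  maxQd S ≤ D → (L : List Formula) → EnumClosure S L → totalLen L ≤ c * suc (totalLen S) ^ k
closure-size-polynomial D = 1 , 2 + D , λ S _ d≤D L enumL →
  let n = totalLen S
      p = suc (length (occurrencesIn S))
      p≤1+n : p ≤ suc n
      p≤1+n = s≤s (≤-trans (m≤n+m _ (maxQd S + maxQd S)) (occurrencesIn-budget S))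
  in begin
    totalLen L                      ≤⟨ closure-totalLen enumL ⟩
    n * n * p ^ maxQd S
      ≤⟨ *-mono-≤ (*-mono-≤ (n≤1+n n) (n≤1+n n)) (≤-trans (^-monoʳ-≤ p d≤D) (^-monoˡ-≤ D p≤1+n)) ⟩
    suc n * suc n * suc n ^ D       ≡⟨ *-assoc (suc n) (suc n) _ ⟩
    suc n ^ (2 + D)                 ≡⟨ *-identityˡ _ ⟨
    1 * suc n ^ (2 + D)             ∎
  where open ≤-Reasoning

proposition6p7 :
    ((S : List Formula) → Unique S → (Ps : List Term) → EnumPars S Ps →
      Σ (List Formula) λ L → EnumClosure S L
        × length L ≤ totalLen S * length Ps ^ maxQd S
        × totalLen L ≤ totalLen S * totalLen S * length Ps ^ maxQd S)
    × (Σ ℕ λ N → (S : List Formula) → Unique S → N ≤ totalLen S →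
        (L : List Formula) → EnumClosure S L →
        totalLen L * totalLen L ≤ totalLen S ^ totalLen S)
    × ((D : ℕ) → Σ ℕ λ c → Σ ℕ λ k → (S : List Formula) → Unique S →
        maxQd S ≤ D → (L : List Formula) → EnumClosure S L →
        totalLen L ≤ c * suc (totalLen S) ^ k)
proposition6p7 = closure-size , closure-size-asymptotic , closure-size-polynomial
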